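{- Let $\mathcal G$ be a family of grid graphs, each equipped with a $2$-coloring of its edges. Then $\operatorname{gr}(\mathcal G)<\infty$ if and only if there exists $N\in\mathbb N$ such that for every $i,j\in[2]$ there is some $G\in\mathcal G$ such that the coloring $\chi_{i,j}$ of $G_{N\times N}$ contains a correctly colored copy of $G$.
   Context: A grid graph on $c$ columns and $r$ rows is a graph with vertex set contained in $[c]\times[r]$ (vertex $(x,y)$ in column $x$, row $y$) whose edges each join two vertices in the same row (horizontal) or the same column (vertical). $G_{N\times N}=K_N\square K_N$ is the complete grid graph on $[N]\times[N]$. A copy of a grid graph $H$ (on $c_H$ columns, $r_H$ rows) in $G_{N\times N}$ is given by injections $\varphi_c:[c_H]\to[N]$, $\varphi_r:[r_H]\to[N]$, edge $\{(x,y),(x',y')\}$ of $H$ being sent to $\{(\varphi_c(x),\varphi_r(y)),(\varphi_c(x'),\varphi_r(y'))\}$; given edge $2$-colorings of $H$ and $G_{N\times N}$, the copy is correctly colored if each edge of $H$ is sent to an edge of the same color. $\operatorname{gr}(\mathcal G)$ is the least $N$ such that every $2$-coloring of $E(G_{N\times N})$ contains a correctly colored copy of some member of $\mathcal G$, and $\infty$ if no such $N$ exists. For $i,j\in[2]$, $\chi_{i,j}$ is the coloring of $E(G_{N\times N})$ giving every horizontal edge color $i$ and every vertical edge color $j$. -}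

module Defs where

open import Data.Fin using (Fin; _≟_)
open import Data.Nat using (ℕ)
open import Data.Product using (_×_; _,_; proj₁; proj₂; Σ; ∃)
open import Data.Sum using (_⊎_)
open import Data.Maybe using (Maybe; just; nothing)
open import Data.Bool using (if_then_else_)
open import Relation.Nullary using (yes; no; ¬_)
open import Relation.Nullary.Decidable using (⌊_⌋)
open import Relation.Binary.PropositionalEquality using (_≡_; refl; sym)
open import Function.Definitions using (Injective)

Colour : Set
Colour = Fin 2

-- Vertex (x , y): column x, row y.
Cell : ℕ → ℕ → Set
Cell c r = Fin c × Fin r

-- V is the vertex set (a subset of [c] × [r]); adj u v ≡ just k means
-- {u , v} is an edge of colour k, adj u v ≡ nothing means no edge.
record ColouredGrid : Set₁ where
  field
    cols rows : ℕ
    V         : Cell cols rows → Set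
    adj       : Cell cols rows → Cell cols rows → Maybe Colour
    adj-sym   : ∀ u v → adj u v ≡ adj v u
    adj-irr   : ∀ u → adj u u ≡ nothing
    adj-V     : ∀ u v k → adj u v ≡ just k → V u × V v
    adj-grid  : ∀ u v k → adj u v ≡ just k →
                (proj₂ u ≡ proj₂ v) ⊎ (proj₁ u ≡ proj₁ v)

-- A 2-colouring of the edges of G_{N×N} = K_N □ K_N.  The colour of the
-- edge {u , v} is col u v; the value on non-adjacent pairs is irrelevant.
record Colouring (N : ℕ) : Set where
  field
    col     : Cell N N → Cell N N → Colour
    col-sym : ∀ u v → col u v ≡ col v u

CorrectCopy : (H : ColouredGrid) (N : ℕ) → Colouring N → Set
CorrectCopy H N χ =
  Σ (Fin (ColouredGrid.cols H) → Fin N) λ φc →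
  Σ (Fin (ColouredGrid.rows H) → Fin N) λ φr →
    Injective _≡_ _≡_ φc × Injective _≡_ _≡_ φr ×
    (∀ u v k → ColouredGrid.adj H u v ≡ just k →
       Colouring.col χ (φc (proj₁ u) , φr (proj₂ u))
                       (φc (proj₁ v) , φr (proj₂ v)) ≡ k)

Arrows : (ColouredGrid → Set) → ℕ → Set₁
Arrows 𝒢 N = (χ : Colouring N) → ∃ λ G → 𝒢 G × CorrectCopy G N χ

grFinite : (ColouredGrid → Set) → Set₁
grFinite 𝒢 = ∃ λ N → Arrows 𝒢 N

private
  ≟-sym : ∀ {n} (a b : Fin n) → ⌊ a ≟ b ⌋ ≡ ⌊ b ≟ a ⌋
  ≟-sym a b with a ≟ b | b ≟ a
  ... | yes _ | yes _ = refl
  ... | no _  | no _  = refl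
  ... | yes p | no ¬q = Data.Empty.⊥-elim (¬q (sym p))
    where import Data.Empty
  ... | no ¬p | yes q = Data.Empty.⊥-elim (¬p (sym q))
    where import Data.Empty

χ : (N : ℕ) → Colour → Colour → Colouring N
χ N i j = record
  { col     = λ u v → if ⌊ proj₂ u ≟ proj₂ v ⌋ then i else j
  ; col-sym = λ u v → helper u v
  }
  where
    helper : ∀ (u v : Cell N N) →
             (if ⌊ proj₂ u ≟ proj₂ v ⌋ then i else j) ≡
             (if ⌊ proj₂ v ≟ proj₂ u ⌋ then i else j)
    helper u v rewrite ≟-sym (proj₂ u) (proj₂ v) = refl

{-# OPTIONS --safe #-}
-- Only ⇐ needs an argument. Colour pairs of columns by the colour of their horizontal edge in
-- a fixed row. Ramsey's theorem applied once for each of 2n₁ rows leaves 2N columns on which each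
-- of these rows is monochromatic, and by pigeonhole n₁ of the rows share one colour i. Repeating
-- this with rows and columns exchanged inside the resulting n₁ × 2N grid leaves N columns and N
-- rows on which every horizontal edge has colour i and every vertical edge colour j: a copy of
-- χ_{i,j} on N × N, into which the hypothesis embeds a member of 𝒢.
module Submission where

open import Defs
open import Data.Fin as Fin using (Fin; zero; suc; inject≤)
open import Data.Fin.Properties using (inject≤-injective)
open import Data.Nat using (ℕ; zero; suc; _+_; _≤_; z≤n; s≤s)
open import Data.Nat.Properties using (+-suc; ≤-reflexive; m≤m+n; m≤n+m; m≤n⇒m⊓n≡m)
open import Data.Product using (_×_; ∃; ∃₂; _,_; proj₁; proj₂)
open import Data.Sum using (_⊎_; inj₁; inj₂)
open import Data.Maybe using (just)
open import Data.List using (List; []; _∷_; length; lookup; take; allFin)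
open import Data.List.Properties using (length-take; length-tabulate)
open import Data.List.Relation.Binary.Sublist.Propositional using (_⊆_; []; _∷_; _∷ʳ_; minimum; ⊆-refl; ⊆-trans)
open import Data.List.Relation.Binary.Sublist.Propositional.Properties using (All-resp-⊆; take-⊆)
open import Data.List.Membership.Propositional.Properties using (∈-lookup)
open import Data.List.Relation.Unary.All as All using (All; []; _∷_)
open import Data.List.Relation.Unary.AllPairs using (AllPairs; []; _∷_)
open import Data.List.Relation.Unary.Unique.Propositional using (Unique)
open import Data.List.Relation.Unary.Unique.Propositional.Properties using (allFin⁺)
open import Function.Base using (_∘_)
open import Function.Bundles using (_⇔_; mk⇔)
open import Function.Definitions using (Injective)
open import Relation.Binary.Definitions using (Symmetric)
open import Relation.Binary.PropositionalEquality using (_≡_; _≢_; refl; sym; trans; cong; subst; ≢-sym)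
open import Relation.Nullary using (yes; no; contradiction)

private
  variable
    A I : Set
    n : ℕ
    xs ys : List A

AllPairs-resp-⊆ : {R : A → A → Set} → xs ⊆ ys → AllPairs R ys → AllPairs R xs
AllPairs-resp-⊆ []         []         = []
AllPairs-resp-⊆ (_ ∷ʳ τ)   (_ ∷ rys)  = AllPairs-resp-⊆ τ rys
AllPairs-resp-⊆ (refl ∷ τ) (ry ∷ rys) = All-resp-⊆ τ ry ∷ AllPairs-resp-⊆ τ rys

length-take-≤ : ∀ k (xs : List A) → k ≤ length xs → length (take k xs) ≡ k
length-take-≤ k xs k≤ = trans (length-take k xs) (m≤n⇒m⊓n≡m k≤)

record LargeSublist (n : ℕ) (xs : List A) (P : List A → Set) : Set where
  constructor large
  field
    elements  : List A
    ⊆xs       : elements ⊆ xs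
    size      : n ≤ length elements
    satisfies : P elements

widen : {P : List A → Set} → ys ⊆ xs → LargeSublist n ys P → LargeSublist n xs P
widen τ (large zs σ size p) = large zs (⊆-trans σ τ) size p

mapLarge : {P Q : List A → Set} → (∀ {zs} → P zs → Q zs) →
           LargeSublist n xs P → LargeSublist n xs Q
mapLarge f (large zs σ size p) = large zs σ size (f p)

0F 1F : Colour
0F = zero
1F = suc zero

pigeonhole : {P : A → Colour → Set} → ∀ m n (xs : List A) →
             All (λ x → ∃ (P x)) xs → m + n ≤ length xs →
             LargeSublist m xs (All (λ x → P x 0F)) ⊎
             LargeSublist n xs (All (λ x → P x 1F))
pigeonhole zero    n       xs       _                    _       = inj₁ (large [] (minimum xs) z≤n [])
pigeonhole (suc m) zero    xs       _                    _       = inj₂ (large [] (minimum xs) z≤n [])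
pigeonhole (suc m) (suc n) (x ∷ xs) ((zero , p) ∷ ps)     (s≤s h)
  with pigeonhole m (suc n) xs ps h
... | inj₁ (large zs τ size ps′) = inj₁ (large (x ∷ zs) (refl ∷ τ) (s≤s size) (p ∷ ps′))
... | inj₂ L                     = inj₂ (widen (x ∷ʳ ⊆-refl) L)
pigeonhole (suc m) (suc n) (x ∷ xs) ((suc zero , p) ∷ ps) (s≤s h)
  with pigeonhole (suc m) n xs ps (subst (_≤ length xs) (+-suc m n) h)
... | inj₁ L                     = inj₁ (widen (x ∷ʳ ⊆-refl) L)
... | inj₂ (large zs τ size ps′) = inj₂ (large (x ∷ zs) (refl ∷ τ) (s≤s size) (p ∷ ps′))

Monochromatic : (A → A → Colour) → Colour → List A → Set
Monochromatic c a = AllPairs (λ x y → c x y ≡ a)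

Homogeneous : (A → A → Colour) → List A → Set
Homogeneous c ys = ∃ λ a → Monochromatic c a ys

ramseyBound : ℕ → ℕ → ℕ
ramseyBound zero    t       = zero
ramseyBound (suc s) zero    = zero
ramseyBound (suc s) (suc t) = suc (ramseyBound s (suc t) + ramseyBound (suc s) t)

module _ (c : A → A → Colour) where

  addApex : ∀ {x a} → ys ⊆ xs → All (λ y → c x y ≡ a) ys →
            LargeSublist n ys (Monochromatic c a) →
            LargeSublist (suc n) (x ∷ xs) (Monochromatic c a)
  addApex τ x-ys (large zs σ size mono) =
    large (_ ∷ zs) (refl ∷ ⊆-trans σ τ) (s≤s size) (All-resp-⊆ σ x-ys ∷ mono)

  ramsey : ∀ s t (xs : List A) → ramseyBound s t ≤ length xs →
           LargeSublist s xs (Monochromatic c 0F) ⊎ LargeSublist t xs (Monochromatic c 1F)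
  ramsey zero    t       xs       _       = inj₁ (large [] (minimum xs) z≤n [])
  ramsey (suc s) zero    xs       _       = inj₂ (large [] (minimum xs) z≤n [])
  ramsey (suc s) (suc t) (x ∷ xs) (s≤s h)
    with pigeonhole {P = λ y a → c x y ≡ a} (ramseyBound s (suc t)) (ramseyBound (suc s) t) xs
                    (All.universal (λ y → c x y , refl) xs) h
  ... | inj₁ (large ys τ size x-ys) with ramsey s (suc t) ys size
  ...   | inj₁ L = inj₁ (addApex τ x-ys L)
  ...   | inj₂ L = inj₂ (widen (x ∷ʳ τ) L)
  ramsey (suc s) (suc t) (x ∷ xs) (s≤s h)
      | inj₂ (large ys τ size x-ys) with ramsey (suc s) t ys size
  ...   | inj₁ L = inj₁ (widen (x ∷ʳ τ) L)
  ...   | inj₂ L = inj₂ (addApex τ x-ys L)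

  diagonalRamsey : ∀ n (xs : List A) → ramseyBound n n ≤ length xs →
                    LargeSublist n xs (Homogeneous c)
  diagonalRamsey n xs h with ramsey n n xs h
  ... | inj₁ L = mapLarge (0F ,_) L
  ... | inj₂ L = mapLarge (1F ,_) L

iteratedRamseyBound : ℕ → ℕ → ℕ
iteratedRamseyBound zero    n = n
iteratedRamseyBound (suc k) n = ramseyBound b b
  where b = iteratedRamseyBound k n

simultaneousRamsey : (c : I → A → A → Colour) → ∀ n (rs : List I) (xs : List A) →
                     iteratedRamseyBound (length rs) n ≤ length xs →
                     LargeSublist n xs (λ ys → All (λ r → Homogeneous (c r) ys) rs)
simultaneousRamsey c n []       xs h = large xs ⊆-refl h []
simultaneousRamsey c n (r ∷ rs) xs h with diagonalRamsey (c r) _ xs h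
... | large ys τ size (a , mono) with simultaneousRamsey c n rs ys size
...   | large zs σ size′ homs = large zs (⊆-trans σ τ) size′ ((a , AllPairs-resp-⊆ σ mono) ∷ homs)

commonColour : (c : I → A → A → Colour) → ∀ m n (rs : List I) (xs : List A) →
               m + m ≤ length rs → iteratedRamseyBound (m + m) n ≤ length xs →
               ∃ λ a → LargeSublist m rs λ rs′ →
                         LargeSublist n xs λ ys → All (λ r → Monochromatic (c r) a ys) rs′
commonColour c m n rs xs h₁ h₂ with length-take-≤ (m + m) rs h₁
... | length-rs₀
  with simultaneousRamsey c n (take (m + m) rs) xs
         (subst (λ k → iteratedRamseyBound k n ≤ length xs) (sym length-rs₀) h₂)
... | large ys τ size homs
  with pigeonhole {P = λ r a → Monochromatic (c r) a ys} m m (take (m + m) rs) homs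
         (≤-reflexive (sym length-rs₀))
... | inj₁ L = 0F , widen (take-⊆ (m + m) rs) (mapLarge (large ys τ size) L)
... | inj₂ L = 1F , widen (take-⊆ (m + m) rs) (mapLarge (large ys τ size) L)

record CanonicalSubgrid {M} (χ′ : Colouring M) (N : ℕ) (i j : Colour) : Set where
  open Colouring χ′
  field
    column            : Fin N → Fin M
    row               : Fin N → Fin M
    column-injective  : Injective _≡_ _≡_ column
    row-injective     : Injective _≡_ _≡_ row
    horizontal-colour : ∀ {p p′} q → p ≢ p′ → col (column p , row q) (column p′ , row q) ≡ i
    vertical-colour   : ∀ p {q q′} → q ≢ q′ → col (column p , row q) (column p , row q′) ≡ j

lookup≤ : (xs : List A) → n ≤ length xs → Fin n → A
lookup≤ xs n≤ p = lookup xs (inject≤ p n≤)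

AllPairs-lookup : {R : A → A → Set} → Symmetric R → AllPairs R xs →
                  ∀ {i j} → i ≢ j → R (lookup xs i) (lookup xs j)
AllPairs-lookup R-sym (r ∷ rs) {zero}  {zero}  0≢0 = contradiction refl 0≢0
AllPairs-lookup R-sym (r ∷ rs) {zero}  {suc j} _   = All.lookup r (∈-lookup j)
AllPairs-lookup R-sym (r ∷ rs) {suc i} {zero}  _   = R-sym (All.lookup r (∈-lookup i))
AllPairs-lookup R-sym (r ∷ rs) {suc i} {suc j} i≢j = AllPairs-lookup R-sym rs (i≢j ∘ cong suc)

AllPairs-lookup≤ : {R : A → A → Set} → Symmetric R → AllPairs R xs →
                   (n≤ : n ≤ length xs) → ∀ {p q} → p ≢ q → R (lookup≤ xs n≤ p) (lookup≤ xs n≤ q)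
AllPairs-lookup≤ R-sym rs n≤ {p} {q} p≢q =
  AllPairs-lookup R-sym rs (p≢q ∘ inject≤-injective n≤ n≤ p q)

lookup≤-injective : Unique xs → (n≤ : n ≤ length xs) → Injective _≡_ _≡_ (lookup≤ xs n≤)
lookup≤-injective unique n≤ {p} {q} eq with p Fin.≟ q
... | yes p≡q = p≡q
... | no  p≢q = contradiction eq (AllPairs-lookup≤ ≢-sym unique n≤ p≢q)

All-lookup≤ : {P : A → Set} → All P xs → (n≤ : n ≤ length xs) → ∀ p → P (lookup≤ xs n≤ p)
All-lookup≤ ps n≤ p = All.lookup ps (∈-lookup (inject≤ p n≤))

module _ {M} (χ′ : Colouring M) where
  open Colouring χ′

  rowColouring : Fin M → Fin M → Fin M → Colour
  rowColouring y x x′ = col (x , y) (x′ , y)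

  columnColouring : Fin M → Fin M → Fin M → Colour
  columnColouring x y y′ = col (x , y) (x , y′)

  fromMonochromaticLines : ∀ {N i j} {C R : List (Fin M)} → C ⊆ allFin M → R ⊆ allFin M →
    (N≤C : N ≤ length C) (N≤R : N ≤ length R) →
    All (λ y → Monochromatic (rowColouring y) i C) R →
    All (λ x → Monochromatic (columnColouring x) j R) C →
    CanonicalSubgrid χ′ N i j
  fromMonochromaticLines {C = C} {R} C⊆ R⊆ N≤C N≤R rows columns = record
    { column            = lookup≤ C N≤C
    ; row               = lookup≤ R N≤R
    ; column-injective  = lookup≤-injective (AllPairs-resp-⊆ C⊆ (allFin⁺ M)) N≤C
    ; row-injective     = lookup≤-injective (AllPairs-resp-⊆ R⊆ (allFin⁺ M)) N≤R
    ; horizontal-colour = λ q → AllPairs-lookup≤ (trans (col-sym _ _))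
                                  (All-lookup≤ rows N≤R q) N≤C
    ; vertical-colour   = λ p → AllPairs-lookup≤ (trans (col-sym _ _))
                                  (All-lookup≤ columns N≤C p) N≤R
    }

gridRamseyBound : ℕ → ℕ
gridRamseyBound N = (n₁ + n₁) + iteratedRamseyBound (n₁ + n₁) (N + N)
  where n₁ = iteratedRamseyBound (N + N) N

canonicalSubgrid : ∀ N (χ′ : Colouring (gridRamseyBound N)) → ∃₂ λ i j → CanonicalSubgrid χ′ N i j
canonicalSubgrid N χ′
  with commonColour (rowColouring χ′) n₁ (N + N) (allFin M) (allFin M)
         (≤-length-allFin (m≤m+n _ _)) (≤-length-allFin (m≤n+m _ _))
  where
    n₁ = iteratedRamseyBound (N + N) N
    M  = gridRamseyBound N
    ≤-length-allFin : ∀ {k} → k ≤ M → k ≤ length (allFin M)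
    ≤-length-allFin = subst (_ ≤_) (sym (length-tabulate (λ x → x)))
... | i , large R₁ R₁⊆ R₁-size (large C₁ C₁⊆ C₁-size rows)
  with commonColour (columnColouring χ′) N N C₁ R₁ C₁-size R₁-size
... | j , large C₂ C₂⊆C₁ C₂-size (large R₂ R₂⊆R₁ R₂-size columns) =
  i , j , fromMonochromaticLines χ′ (⊆-trans C₂⊆C₁ C₁⊆) (⊆-trans R₂⊆R₁ R₁⊆) C₂-size R₂-size
            (All.map (AllPairs-resp-⊆ C₂⊆C₁) (All-resp-⊆ R₂⊆R₁ rows)) columns

χ-horizontal : ∀ {N} i j (x x′ y : Fin N) → Colouring.col (χ N i j) (x , y) (x′ , y) ≡ i
χ-horizontal i j x x′ y with y Fin.≟ y
... | yes _   = refl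
... | no  y≢y = contradiction refl y≢y

χ-vertical : ∀ {N} i j (x x′ : Fin N) {y y′} → y ≢ y′ → Colouring.col (χ N i j) (x , y) (x′ , y′) ≡ j
χ-vertical i j x x′ {y} {y′} y≢y′ with y Fin.≟ y′
... | yes y≡y′ = contradiction y≡y′ y≢y′
... | no  _    = refl

adjacent⇒≢ : (G : ColouredGrid) → ∀ {u v k} → ColouredGrid.adj G u v ≡ just k → u ≢ v
adjacent⇒≢ G {u} uv refl with trans (sym uv) (ColouredGrid.adj-irr G u)
... | ()

liftCopy : ∀ {G M N i j} {χ′ : Colouring M} → CanonicalSubgrid χ′ N i j →
           CorrectCopy G N (χ N i j) → CorrectCopy G M χ′
liftCopy {G} {i = i} {j} {χ′} S (ψc , ψr , ψc-injective , ψr-injective , ψ-correct) =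
  column ∘ ψc , row ∘ ψr ,
  (λ e → ψc-injective (column-injective e)) , (λ e → ψr-injective (row-injective e)) ,
  correct
  where
    open CanonicalSubgrid S
    open ColouredGrid G
    open Colouring χ′
    correct : ∀ u v k → adj u v ≡ just k →
              col (column (ψc (proj₁ u)) , row (ψr (proj₂ u)))
                  (column (ψc (proj₁ v)) , row (ψr (proj₂ v))) ≡ k
    correct (x , y) (x′ , y′) k uv with adj-grid _ _ k uv
    ... | inj₁ refl = trans (horizontal-colour (ψr y) ψx≢ψx′)
                            (trans (sym (χ-horizontal i j (ψc x) (ψc x′) (ψr y))) (ψ-correct _ _ k uv))
      where
        ψx≢ψx′ : ψc x ≢ ψc x′
        ψx≢ψx′ = adjacent⇒≢ G uv ∘ cong (_, y) ∘ ψc-injective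
    ... | inj₂ refl = trans (vertical-colour (ψc x) ψy≢ψy′)
                            (trans (sym (χ-vertical i j (ψc x) (ψc x) ψy≢ψy′)) (ψ-correct _ _ k uv))
      where
        ψy≢ψy′ : ψr y ≢ ψr y′
        ψy≢ψy′ = adjacent⇒≢ G uv ∘ cong (x ,_) ∘ ψr-injective

proposition2p3 : (𝒢 : ColouredGrid → Set) →
    grFinite 𝒢 ⇔
      (∃ λ N → (i j : Colour) → ∃ λ G → 𝒢 G × CorrectCopy G N (χ N i j))
proposition2p3 𝒢 = mk⇔ (λ (N , 𝒢-arrows) → N , λ i j → 𝒢-arrows (χ N i j)) copies⇒grFinite
  where
    copies⇒grFinite : (∃ λ N → (i j : Colour) → ∃ λ G → 𝒢 G × CorrectCopy G N (χ N i j)) →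
                      grFinite 𝒢
    copies⇒grFinite (N , copies) = gridRamseyBound N , λ χ′ →
      let (i , j , S) = canonicalSubgrid N χ′
          (G , G∈𝒢 , copy) = copies i j
      in G , G∈𝒢 , liftCopy {G} S copy
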